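{- Let $h\ge1$ and $r\ge1$ be natural numbers and let $k_1,\dots,k_r$ be natural numbers with $1\le k_i\le h$. Then there exists a word $A\in\mathsf{W}^N_3$ such that $\mathbf{u}(A)=(K_{h,k_1},\dots,K_{h,k_r})$.
   Context: A word is a finite string over $\mathbb{N}$; $\Lambda$ is the empty word, juxtaposition is concatenation, $A^n$ is the $n$-fold concatenation. $\mathsf{S}_k$ is the set of words all of whose symbols are $\ge k$; $\mathsf{W}_3$ is the set of words with all symbols $\le3$. A relation $\precsim$ on words is defined by induction on (maximal symbol minus minimal symbol) of $AB$: $\Lambda\precsim\Lambda$; if $AB$ is nonempty with minimal symbol $n$, write uniquely $A=A_1n\dots nA_k$, $B=B_1n\dots nB_l$ with $k,l\ge1$ and all $A_i,B_j\in\mathsf{S}_{n+1}$; let $(C_i)$, $(D_j)$ be lexicographically maximal subsequences of $(A_1,\dots,A_k)$, $(B_1,\dots,B_l)$; then $A\precsim B$ iff $(C_i)$ is lexicographically not greater than $(D_j)$. Here $(X_1,\dots,X_p)$ is lexicographically not greater than $(Y_1,\dots,Y_q)$ iff either $p\le q$ and $X_i\sim Y_i$ for all $i\le p$, or there is $s<\min(p,q)$ with $X_i\sim Y_i$ for $i\le s$ and $X_{s+1}\precsim Y_{s+1}$; a lexicographically maximal subsequence is one lexicographically not less than every subsequence. $A\sim B$ iff $A\precsim B$ and $B\precsim A$. $\mathsf{NF}$: $\Lambda\in\mathsf{NF}$; a nonempty word with minimal symbol $n$, written $A_1n\dots nA_k$ with $k\ge2$, $A_i\in\mathsf{S}_{n+1}$,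 is in $\mathsf{NF}$ iff $A_k\precsim\dots\precsim A_1$ and all $A_i\in\mathsf{NF}$. For $A\in\mathsf{NF}$, $\Diamond_nA$ is the unique word of $\mathsf{NF}$ equivalent to $An$. $\mathsf{W}^N_3=\mathsf{W}_3\cap\mathsf{NF}$. Let $I_s$ be the word $3^s2$; for $1\le k\le h$ let $K_{h,k}=I_{h-1}I_{h-2}\dots I_{k+1}I_k3^k$. For $A\in\mathsf{W}^N_3$ written (uniquely) as $A=A_r0A_{r-1}0\dots0A_1$ with all $A_i\in\mathsf{S}_1\cap\mathsf{W}^N_3$, let $\mathbf{u}(A)=(u_1(A),\dots,u_r(A))$ with $u_i(A)=\Diamond_3(A_r0A_{r-1}0\dots0A_i)$. -}

module Defs where

open import Data.Nat using (ℕ; zero; suc; _∸_; _⊔_; _⊓_; _≤_; _+_; _≡ᵇ_)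
open import Data.Bool using (if_then_else_)
open import Data.List using (List; []; _∷_; _++_; [_]; length; foldr; replicate; concat; map; reverse; applyUpTo; take; intercalate)
open import Data.List.Relation.Binary.Sublist.Propositional using (_⊆_)
open import Data.List.Relation.Unary.Linked using (Linked)
open import Data.List.Relation.Unary.All using (All)
open import Data.Product using (Σ; _×_)
open import Data.Sum using (_⊎_)
open import Data.Unit using (⊤)
open import Data.Empty using (⊥)
open import Relation.Nullary using (¬_)

Word : Set
Word = List ℕ

-- minimal / maximal symbol (only meaningful for nonempty words)
minW : Word → ℕ
minW []       = 0
minW (x ∷ xs) = foldr _⊓_ x xs

maxW : Word → ℕ
maxW []       = 0
maxW (x ∷ xs) = foldr _⊔_ x xs

-- split n A = (A₁ , … , A_k)  where  A = A₁ n A₂ n … n A_k  (k ≥ 1),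
-- the Aᵢ not containing the symbol n.
split : ℕ → Word → List Word
split n [] = [] ∷ []
split n (x ∷ xs) with split n xs
... | []       = [ x ∷ [] ]   -- impossible case
... | (w ∷ ws) = if x ≡ᵇ n then [] ∷ w ∷ ws else (x ∷ w) ∷ ws

module _ (R : Word → Word → Set) where
  Equiv : Word → Word → Set
  Equiv X Y = R X Y × R Y X

  Strict : Word → Word → Set
  Strict X Y = R X Y × ¬ R Y X

  LexLe : List Word → List Word → Set
  LexLe []       _        = ⊤
  LexLe (x ∷ xs) []       = ⊥
  LexLe (x ∷ xs) (y ∷ ys) = Strict x y ⊎ (Equiv x y × LexLe xs ys)

  LexMax : List Word → List Word → Set
  LexMax Xs C = C ⊆ Xs × ((S : List Word) → S ⊆ Xs → LexLe S C)

-- ≾ with fuel (the definition is by induction on max - min of AB)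
Leq : ℕ → Word → Word → Set
Leq _       []       []       = ⊤
Leq zero    _        _        = ⊥
Leq (suc f) A B =
  Σ (List Word) λ C → Σ (List Word) λ D →
    LexMax (Leq f) (split n A) C × LexMax (Leq f) (split n B) D × LexLe (Leq f) C D
  where n = minW (A ++ B)

_≾_ : Word → Word → Set
A ≾ B = Leq (suc (maxW (A ++ B) ∸ minW (A ++ B))) A B

_∼_ : Word → Word → Set
A ∼ B = (A ≾ B) × (B ≾ A)

NF' : ℕ → Word → Set
NF' _       []      = ⊤
NF' zero    (_ ∷ _) = ⊥
NF' (suc f) A@(_ ∷ _) =
  2 ≤ length cs × Linked (λ X Y → Y ≾ X) cs × All (NF' f) cs
  where cs = split (minW A) A

NF : Word → Set
NF A = NF' (suc (maxW A ∸ minW A)) A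

W3 : Word → Set
W3 A = All (_≤ 3) A

-- D is ◇ₙ A, i.e. the (unique) word of NF equivalent to A n
IsDiamond : ℕ → Word → Word → Set
IsDiamond n A D = NF D × (D ∼ (A ++ [ n ]))

I : ℕ → Word
I s = replicate s 3 ++ [ 2 ]

-- K_{h,k} = I_{h-1} I_{h-2} … I_k 3^k
K : ℕ → ℕ → Word
K h k = concat (map I (reverse (applyUpTo (λ j → k + j) (h ∸ k)))) ++ replicate k 3

-- for A = A_r 0 A_{r-1} 0 … 0 A_1, the list of words
-- (A_r 0 … 0 A_1 , A_r 0 … 0 A_2 , … , A_r), whose ◇₃ are u₁(A), …, u_r(A)
uArgs : Word → List Word
uArgs A = reverse (applyUpTo (λ j → intercalate [ 0 ] (take (suc j) cs)) (length cs))
  where cs = split 0 A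

IsU : Word → List Word → Set
IsU A Ks = Pointwise (IsDiamond 3) (uArgs A) Ks
  where open import Data.List.Relation.Binary.Pointwise using (Pointwise)

-- A = A_r 0 A_{r−1} 0 ⋯ 0 A_1 with A_i = (Z 1)^i Y_{k_i}, where Y_k is K_{h,k} without its last 3
-- and Z = Y_1 = I_{h−1} ⋯ I_1.  A word I_{a_1} ⋯ I_{a_n} 3^m with a_1 ≥ ⋯ ≥ a_n ≥ m splits at 2 into
-- the blocks 3^{a_i}, 3^m, so such words compare like their exponent lists; on the Y_k and K_{h,k}
-- this is the order of the ranks h − k and h + k, so every Y lies strictly below every K.
-- Hence the components at 1 of (Z 1)^i K_{h,k} are Z, …, Z, K_{h,k}, whose maximal subsequence is
-- K_{h,k} alone, and (Z 1)^i K_{h,k} ∼ K_{h,k}.  The components at 0 of A_r 0 ⋯ 0 A_i 3 are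
-- A_r, …, A_{i+1}, (Z 1)^i K_{h,k_i}, and each A_j lies below the last one because its first
-- component Z has rank h − 1 < h + k_i.  So A_r 0 ⋯ 0 A_i 3 ∼ K_{h,k_i}, which is normal, i.e.
-- u_i(A) = K_{h,k_i}; and A is normal because the A_i are normal and increase with i.
module Submission where

open import Defs
open import Data.Nat using (ℕ; _≤_)
open import Data.Vec using (Vec; toList)
open import Data.Vec.Relation.Unary.All using (All)
open import Data.List using (map)
open import Data.Product using (Σ; _×_)

open import Data.Bool using (true; false; T; if_then_else_)
open import Data.Empty using (⊥; ⊥-elim)
open import Data.List using (List; []; _∷_; _++_; [_]; foldr; length; concat; replicate; intercalate; reverse; applyUpTo; applyDownFrom; take)
open import Data.List.Membership.Propositional using (_∈_)
open import Data.List.Membership.Propositional.Properties using (∈-++⁺ˡ; ∈-++⁺ʳ)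
open import Data.List.Properties using (++-assoc; map-replicate; map-id; map-++; reverse-applyUpTo; reverse-map; reverse-involutive; length-reverse)
open import Data.List.Relation.Binary.Pointwise as Pointwise using (Pointwise; []; _∷_)
open import Data.List.Relation.Binary.Sublist.Propositional using (_⊆_; []; _∷_; _∷ʳ_; ⊆-refl)
open import Data.List.Relation.Binary.Sublist.Propositional.Properties using (map⁺; All-resp-⊆; ++⁺ˡ)
open import Data.List.Relation.Unary.All as All using ([]; _∷_) renaming (All to ListAll)
import Data.List.Relation.Unary.All.Properties as All
open import Data.List.Relation.Unary.Any using (here; there)
import Data.List.Relation.Unary.Any.Properties as Any
open import Data.List.Relation.Unary.Linked as Linked using (Linked; []; [-]; _∷_)
open import Data.Nat using (zero; suc; _<_; _≥_; _+_; _∸_; _⊓_; _⊔_; _≡ᵇ_; z≤n; s≤s; s≤s⁻¹)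
open import Data.Nat.Properties
open import Data.Nat.Tactic.RingSolver using (solve-∀)
open import Data.Product using (_,_; proj₁; proj₂)
open import Data.Sum using (_⊎_; inj₁; inj₂)
open import Data.Unit using (⊤; tt)
open import Data.Vec.Properties using (length-toList)
import Data.Vec.Relation.Unary.All.Properties as VAll
open import Function using (_∘_; id)
open import Function.Bundles using (_⇔_; mk⇔; Equivalence)
import Function.Properties.Equivalence as ⇔
open import Relation.Binary.Definitions using (tri<; tri≈; tri>)
open import Relation.Binary.PropositionalEquality hiding ([_])
open import Relation.Nullary using (¬_)

-- Lexicographic order on lists of naturals

infix 4 _≤ₗ_ _<ₗ_

_≤ₗ_ : List ℕ → List ℕ → Set
[]     ≤ₗ _      = ⊤
x ∷ xs ≤ₗ []     = ⊥
x ∷ xs ≤ₗ y ∷ ys = x < y ⊎ (x ≡ y × xs ≤ₗ ys)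

_<ₗ_ : List ℕ → List ℕ → Set
[]     <ₗ []     = ⊥
[]     <ₗ _ ∷ _  = ⊤
x ∷ xs <ₗ []     = ⊥
x ∷ xs <ₗ y ∷ ys = x < y ⊎ (x ≡ y × xs <ₗ ys)

≤ₗ-refl : ∀ xs → xs ≤ₗ xs
≤ₗ-refl []       = tt
≤ₗ-refl (x ∷ xs) = inj₂ (refl , ≤ₗ-refl xs)

≤ₗ-antisym : ∀ xs ys → xs ≤ₗ ys → ys ≤ₗ xs → xs ≡ ys
≤ₗ-antisym []       []       _                 _                = refl
≤ₗ-antisym (x ∷ xs) (y ∷ ys) (inj₁ x<y)        (inj₁ y<x)       = ⊥-elim (<-asym x<y y<x)
≤ₗ-antisym (x ∷ xs) (y ∷ ys) (inj₁ x<y)        (inj₂ (y≡x , _)) = ⊥-elim (<-irrefl (sym y≡x) x<y)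
≤ₗ-antisym (x ∷ xs) (y ∷ ys) (inj₂ (x≡y , _))  (inj₁ y<x)       = ⊥-elim (<-irrefl (sym x≡y) y<x)
≤ₗ-antisym (x ∷ xs) (y ∷ ys) (inj₂ (refl , p)) (inj₂ (_ , q))   = cong (x ∷_) (≤ₗ-antisym xs ys p q)

<ₗ⇒≤ₗ : ∀ xs ys → xs <ₗ ys → xs ≤ₗ ys
<ₗ⇒≤ₗ []       ys       _                = tt
<ₗ⇒≤ₗ (x ∷ xs) (y ∷ ys) (inj₁ x<y)       = inj₁ x<y
<ₗ⇒≤ₗ (x ∷ xs) (y ∷ ys) (inj₂ (x≡y , p)) = inj₂ (x≡y , <ₗ⇒≤ₗ xs ys p)

<ₗ⇒≱ₗ : ∀ xs ys → xs <ₗ ys → ¬ ys ≤ₗ xs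
<ₗ⇒≱ₗ []       (y ∷ ys) _                ()
<ₗ⇒≱ₗ (x ∷ xs) (y ∷ ys) (inj₁ x<y)       (inj₁ y<x)       = <-asym x<y y<x
<ₗ⇒≱ₗ (x ∷ xs) (y ∷ ys) (inj₁ x<y)       (inj₂ (y≡x , _)) = <-irrefl (sym y≡x) x<y
<ₗ⇒≱ₗ (x ∷ xs) (y ∷ ys) (inj₂ (x≡y , _)) (inj₁ y<x)       = <-irrefl (sym x≡y) y<x
<ₗ⇒≱ₗ (x ∷ xs) (y ∷ ys) (inj₂ (_ , p))   (inj₂ (_ , q))   = <ₗ⇒≱ₗ xs ys p q

++⁺-<ₗ : ∀ zs {xs ys} → xs <ₗ ys → zs ++ xs <ₗ zs ++ ys
++⁺-<ₗ []       p = p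
++⁺-<ₗ (z ∷ zs) p = inj₂ (refl , ++⁺-<ₗ zs p)

[]-≤ₗ⇔ : ∀ {m n} → [ m ] ≤ₗ [ n ] ⇔ m ≤ n
[]-≤ₗ⇔ = mk⇔ to from
  where
  to : ∀ {m n} → [ m ] ≤ₗ [ n ] → m ≤ n
  to (inj₁ m<n)       = <⇒≤ m<n
  to (inj₂ (m≡n , _)) = ≤-reflexive m≡n
  from : ∀ {m n} → m ≤ n → [ m ] ≤ₗ [ n ]
  from m≤n with m≤n⇒m<n∨m≡n m≤n
  ... | inj₁ m<n = inj₁ m<n
  ... | inj₂ m≡n = inj₂ (m≡n , tt)

NonIncreasing : List ℕ → Set
NonIncreasing = Linked _≥_

replicate-++-nonIncreasing : ∀ n {a b} → b ≤ a → NonIncreasing (replicate n a ++ [ b ])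
replicate-++-nonIncreasing zero          b≤a = [-]
replicate-++-nonIncreasing (suc zero)    b≤a = b≤a ∷ [-]
replicate-++-nonIncreasing (suc (suc n)) b≤a = ≤-refl ∷ replicate-++-nonIncreasing (suc n) b≤a

replicate-++-≤ₗ : ∀ n {a b} ys → b ≤ a → replicate n a ++ [ b ] ≤ₗ replicate (suc n) a ++ ys
replicate-++-≤ₗ zero    ys b≤a = Equivalence.from []-≤ₗ⇔ b≤a
replicate-++-≤ₗ (suc n) ys b≤a = inj₂ (refl , replicate-++-≤ₗ n ys b≤a)

IsLexMax : List ℕ → List ℕ → Set
IsLexMax xs cs = cs ⊆ xs × (∀ ss → ss ⊆ xs → ss ≤ₗ cs)

≤ₗ-∷ : ∀ {x xs} ss → NonIncreasing (x ∷ xs) → ss ≤ₗ xs → ss ≤ₗ x ∷ xs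
≤ₗ-∷ {xs = []}     []       _            _                = tt
≤ₗ-∷ {xs = y ∷ xs} []       _            _                = tt
≤ₗ-∷ {xs = y ∷ xs} (s ∷ ss) (x≥y ∷ _)    (inj₁ s<y)       = inj₁ (<-≤-trans s<y x≥y)
≤ₗ-∷ {x} {y ∷ xs} (s ∷ ss) (x≥y ∷ desc) (inj₂ (refl , p)) with m≤n⇒m<n∨m≡n x≥y
... | inj₁ s<x = inj₁ s<x
... | inj₂ refl = inj₂ (refl , ≤ₗ-∷ ss desc p)

nonIncreasing⇒isLexMax : ∀ {xs} → NonIncreasing xs → IsLexMax xs xs
nonIncreasing⇒isLexMax desc = ⊆-refl , λ ss ss⊆ → go desc ss⊆
  where
  go : ∀ {xs ss} → NonIncreasing xs → ss ⊆ xs → ss ≤ₗ xs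
  go _    []           = tt
  go desc (_ ∷ʳ ss⊆)   = ≤ₗ-∷ _ desc (go (Linked.tail desc) ss⊆)
  go desc (refl ∷ ss⊆) = inj₂ (refl , go (Linked.tail desc) ss⊆)

isLexMax-∷ʳ : ∀ {m} xs → ListAll (_< m) xs → IsLexMax (xs ++ [ m ]) [ m ]
isLexMax-∷ʳ xs xs<m = ++⁺ˡ xs ⊆-refl , λ ss ss⊆ → go xs xs<m ss⊆
  where
  go : ∀ {m ss} xs → ListAll (_< m) xs → ss ⊆ xs ++ [ m ] → ss ≤ₗ [ m ]
  go []       _           (_ ∷ʳ [])    = tt
  go []       _           (refl ∷ [])  = inj₂ (refl , tt)
  go (x ∷ xs) (_ ∷ xs<m)  (_ ∷ʳ ss⊆)   = go xs xs<m ss⊆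
  go (x ∷ xs) (x<m ∷ _)   (refl ∷ ss⊆) = inj₁ x<m

⊆-map⁻ : ∀ {A B : Set} (f : A → B) xs {ss} → ss ⊆ map f xs → Σ (List A) λ ts → ts ⊆ xs × ss ≡ map f ts
⊆-map⁻ f []       []            = [] , [] , refl
⊆-map⁻ f (x ∷ xs) (_ ∷ʳ ss⊆)    with ⊆-map⁻ f xs ss⊆
... | ts , ts⊆ , refl = ts , x ∷ʳ ts⊆ , refl
⊆-map⁻ f (x ∷ xs) (refl ∷ ss⊆) with ⊆-map⁻ f xs ss⊆
... | ts , ts⊆ , refl = x ∷ ts , refl ∷ ts⊆ , refl

replicate-nonIncreasing : ∀ n x → NonIncreasing (replicate n x)
replicate-nonIncreasing zero          x = []
replicate-nonIncreasing (suc zero)    x = [-]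
replicate-nonIncreasing (suc (suc n)) x = ≤-refl ∷ replicate-nonIncreasing (suc n) x

replicate-≤ₗ⇔ : ∀ {x} a b → replicate a x ≤ₗ replicate b x ⇔ a ≤ b
replicate-≤ₗ⇔ a b = mk⇔ (to a b) (from a b)
  where
  to : ∀ {x} a b → replicate a x ≤ₗ replicate b x → a ≤ b
  to zero    b       _                = z≤n
  to (suc a) (suc b) (inj₁ x<x)       = ⊥-elim (<-irrefl refl x<x)
  to (suc a) (suc b) (inj₂ (_ , a≤b)) = s≤s (to a b a≤b)
  from : ∀ {x} a b → a ≤ b → replicate a x ≤ₗ replicate b x
  from zero    b       _         = tt
  from (suc a) (suc b) (s≤s a≤b) = inj₂ (refl , from a b a≤b)

module _ {X : Set} (Ok : X → Set) (f : X → List ℕ) (r : X → ℕ)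
  (r-<⇒<ₗ : ∀ {x y} → Ok x → Ok y → r x < r y → f x <ₗ f y)
  (r-injective : ∀ {x y} → Ok x → Ok y → r x ≡ r y → x ≡ y) where

  ≤ₗ⇔≤-by-rank : ∀ {x y} → Ok x → Ok y → f x ≤ₗ f y ⇔ r x ≤ r y
  ≤ₗ⇔≤-by-rank {x} {y} ox oy = mk⇔ to from
    where
    to : f x ≤ₗ f y → r x ≤ r y
    to fx≤fy = ≮⇒≥ (λ ry<rx → <ₗ⇒≱ₗ (f y) (f x) (r-<⇒<ₗ oy ox ry<rx) fx≤fy)
    from : r x ≤ r y → f x ≤ₗ f y
    from rx≤ry with m≤n⇒m<n∨m≡n rx≤ry
    ... | inj₁ rx<ry = <ₗ⇒≤ₗ (f x) (f y) (r-<⇒<ₗ ox oy rx<ry)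
    ... | inj₂ rx≡ry rewrite r-injective ox oy rx≡ry = ≤ₗ-refl (f y)

≤⇒offset : ∀ {m n} → m ≤ n → Σ ℕ λ o → n ≡ m + o
≤⇒offset {n = n} z≤n = n , refl
≤⇒offset (s≤s m≤n) with ≤⇒offset m≤n
... | o , refl = o , refl

applyDownFrom-+ : ∀ k a b → applyDownFrom (k +_) (b + a) ≡ applyDownFrom ((k + a) +_) b ++ applyDownFrom (k +_) a
applyDownFrom-+ k a zero    = refl
applyDownFrom-+ k a (suc b) =
  cong₂ _∷_ (trans (cong (k +_) (+-comm b a)) (sym (+-assoc k a b))) (applyDownFrom-+ k a b)

applyDownFrom-+-nonIncreasing : ∀ k n {m} → m ≤ k → NonIncreasing (applyDownFrom (k +_) n ++ [ m ])
applyDownFrom-+-nonIncreasing k zero          m≤k = [-]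
applyDownFrom-+-nonIncreasing k (suc zero)    m≤k = ≤-trans m≤k (m≤m+n k 0) ∷ [-]
applyDownFrom-+-nonIncreasing k (suc (suc n)) m≤k = +-monoʳ-≤ k (n≤1+n n) ∷ applyDownFrom-+-nonIncreasing k (suc n) m≤k

prefix-<ₗ : ∀ P x rest y → P ++ [ x ] <ₗ (P ++ x ∷ rest) ++ [ y ]
prefix-<ₗ P x rest y = subst (P ++ [ x ] <ₗ_) (sym (++-assoc P (x ∷ rest) [ y ])) (++⁺-<ₗ P (inj₂ (refl , []<ₗ rest)))
  where
  []<ₗ : ∀ rest → [] <ₗ rest ++ [ y ]
  []<ₗ []      = tt
  []<ₗ (_ ∷ _) = tt

differ-<ₗ : ∀ P {x y} xs zs ys → x < y → (P ++ x ∷ xs) ++ zs <ₗ P ++ y ∷ ys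
differ-<ₗ P xs zs ys x<y = subst (_<ₗ P ++ _ ∷ ys) (sym (++-assoc P (_ ∷ xs) zs)) (++⁺-<ₗ P (inj₁ x<y))

replicate-∷ʳ : ∀ {A : Set} n {x : A} → replicate n x ++ [ x ] ≡ x ∷ replicate n x
replicate-∷ʳ zero    = refl
replicate-∷ʳ (suc n) = cong (_ ∷_) (replicate-∷ʳ n)

applyUpTo-cong : ∀ {A : Set} {f g : ℕ → A} → (∀ i → f i ≡ g i) → ∀ n → applyUpTo f n ≡ applyUpTo g n
applyUpTo-cong f≗g zero    = refl
applyUpTo-cong f≗g (suc n) = cong₂ _∷_ (f≗g 0) (applyUpTo-cong (f≗g ∘ suc) n)

offsets-+ : ∀ i a b → suc (suc i + a) + b ≡ suc i + (b + suc a)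
offsets-+ = solve-∀

-- Minimum, maximum and splitting of words

⊓-fold-≤ : ∀ {y} x xs → y ∈ x ∷ xs → foldr _⊓_ x xs ≤ y
⊓-fold-≤ x []       (here refl)         = ≤-refl
⊓-fold-≤ x (z ∷ zs) (here refl)         = ≤-trans (m⊓n≤n z _) (⊓-fold-≤ x zs (here refl))
⊓-fold-≤ x (z ∷ zs) (there (here refl)) = m⊓n≤m z _
⊓-fold-≤ x (z ∷ zs) (there (there p))   = ≤-trans (m⊓n≤n z _) (⊓-fold-≤ x zs (there p))

⊓-fold-glb : ∀ {n} x xs → ListAll (n ≤_) (x ∷ xs) → n ≤ foldr _⊓_ x xs
⊓-fold-glb x []       (p ∷ [])     = p
⊓-fold-glb x (z ∷ zs) (p ∷ q ∷ ps) = ⊓-glb q (⊓-fold-glb x zs (p ∷ ps))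

⊔-fold-≥ : ∀ {y} x xs → y ∈ x ∷ xs → y ≤ foldr _⊔_ x xs
⊔-fold-≥ x []       (here refl)         = ≤-refl
⊔-fold-≥ x (z ∷ zs) (here refl)         = ≤-trans (⊔-fold-≥ x zs (here refl)) (m≤n⊔m z _)
⊔-fold-≥ x (z ∷ zs) (there (here refl)) = m≤m⊔n z _
⊔-fold-≥ x (z ∷ zs) (there (there p))   = ≤-trans (⊔-fold-≥ x zs (there p)) (m≤n⊔m z _)

⊔-fold-lub : ∀ {n} x xs → ListAll (_≤ n) (x ∷ xs) → foldr _⊔_ x xs ≤ n
⊔-fold-lub x []       (p ∷ [])     = p
⊔-fold-lub x (z ∷ zs) (p ∷ q ∷ ps) = ⊔-lub q (⊔-fold-lub x zs (p ∷ ps))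

minW-≤ : ∀ {W y} → y ∈ W → minW W ≤ y
minW-≤ {x ∷ xs} = ⊓-fold-≤ x xs

maxW-≥ : ∀ {W y} → y ∈ W → y ≤ maxW W
maxW-≥ {x ∷ xs} = ⊔-fold-≥ x xs

minW-≡ : ∀ {W n} → n ∈ W → ListAll (n ≤_) W → minW W ≡ n
minW-≡ {x ∷ xs} n∈ n≤ = ≤-antisym (minW-≤ n∈) (⊓-fold-glb x xs n≤)

Within : ℕ → ℕ → ℕ → Set
Within lo d x = lo ≤ x × x ≤ lo + d

height : Word → ℕ
height W = maxW W ∸ minW W

height-≤ : ∀ {lo d} W → ListAll (Within lo d) W → height W ≤ d
height-≤ []       _ = z≤n
height-≤ {lo} {d} (x ∷ xs) w = begin
  maxW (x ∷ xs) ∸ minW (x ∷ xs)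
    ≤⟨ ∸-mono (⊔-fold-lub x xs (All.map proj₂ w)) (⊓-fold-glb x xs (All.map proj₁ w)) ⟩
  lo + d ∸ lo                   ≡⟨ m+n∸m≡n lo d ⟩
  d                             ∎
  where open ≤-Reasoning

Within-height : ∀ W → ListAll (Within (minW W) (height W)) W
Within-height W = All.tabulate λ x∈ →
  minW-≤ x∈ , ≤-trans (maxW-≥ x∈) (≤-reflexive (sym (m+[n∸m]≡n (≤-trans (minW-≤ x∈) (maxW-≥ x∈)))))

≡ᵇ-refl : ∀ n → (n ≡ᵇ n) ≡ true
≡ᵇ-refl zero    = refl
≡ᵇ-refl (suc n) = ≡ᵇ-refl n

≢⇒≡ᵇ-false : ∀ {x n} → x ≢ n → (x ≡ᵇ n) ≡ false
≢⇒≡ᵇ-false {zero}  {zero}  x≢n = ⊥-elim (x≢n refl)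
≢⇒≡ᵇ-false {zero}  {suc n} _   = refl
≢⇒≡ᵇ-false {suc x} {zero}  _   = refl
≢⇒≡ᵇ-false {suc x} {suc n} x≢n = ≢⇒≡ᵇ-false (x≢n ∘ cong suc)

split-∷ : ∀ n x xs {w ws} → split n xs ≡ w ∷ ws →
          split n (x ∷ xs) ≡ (if x ≡ᵇ n then [] ∷ w ∷ ws else (x ∷ w) ∷ ws)
split-∷ n x xs eq rewrite eq = refl

split-nonempty : ∀ n xs → Σ Word λ w → Σ (List Word) λ ws → split n xs ≡ w ∷ ws
split-nonempty n []       = [] , [] , refl
split-nonempty n (x ∷ xs) with split-nonempty n xs
... | w , ws , eq with x ≡ᵇ n | split-∷ n x xs eq
... | true  | eq′ = [] , w ∷ ws , eq′
... | false | eq′ = x ∷ w , ws , eq′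

split-∷-≢ : ∀ {n x} xs {w ws} → x ≢ n → split n xs ≡ w ∷ ws → split n (x ∷ xs) ≡ (x ∷ w) ∷ ws
split-∷-≢ {n} {x} xs x≢n eq rewrite split-∷ n x xs eq | ≢⇒≡ᵇ-false x≢n = refl

split-∷-≡ : ∀ {n} xs → split n (n ∷ xs) ≡ [] ∷ split n xs
split-∷-≡ {n} xs with split-nonempty n xs
... | w , ws , eq rewrite split-∷ n n xs eq | ≡ᵇ-refl n | eq = refl

split-free : ∀ {n} w → ListAll (_≢ n) w → split n w ≡ [ w ]
split-free []       _           = refl
split-free (x ∷ w) (x≢n ∷ w≢n) = split-∷-≢ w x≢n (split-free w w≢n)

split-++ : ∀ {n} w rest → ListAll (_≢ n) w → split n (w ++ n ∷ rest) ≡ w ∷ split n rest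
split-++ []      rest _           = split-∷-≡ rest
split-++ (x ∷ w) rest (x≢n ∷ w≢n) = split-∷-≢ (w ++ _ ∷ rest) x≢n (split-++ w rest w≢n)

split-intercalate : ∀ {n} W Ws → ListAll (ListAll (_≢ n)) (W ∷ Ws) → split n (intercalate [ n ] (W ∷ Ws)) ≡ W ∷ Ws
split-intercalate W []        (W≢n ∷ [])  = split-free W W≢n
split-intercalate W (W′ ∷ Ws) (W≢n ∷ Ws≢n) =
  trans (split-++ W _ W≢n) (cong (W ∷_) (split-intercalate W′ Ws Ws≢n))

split-replicate : ∀ c a → split c (replicate a c) ≡ replicate (suc a) []
split-replicate c zero    = refl
split-replicate c (suc a) = trans (split-∷-≡ (replicate a c)) (cong ([] ∷_) (split-replicate c a))

All-split : ∀ {P : ℕ → Set} n W → ListAll P W → ListAll (ListAll (λ x → P x × x ≢ n)) (split n W)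
All-split n []       []         = [] ∷ []
All-split n (x ∷ xs) (px ∷ pxs) with split-nonempty n xs | All-split n xs pxs
... | w , ws , eq | pws with subst (ListAll _) eq pws
... | pw ∷ pws′ rewrite split-∷ n x xs eq with x ≡ᵇ n in x≡ᵇn
... | true  = [] ∷ pw ∷ pws′
... | false = ((px , λ x≡n → subst T x≡ᵇn (≡⇒≡ᵇ x n x≡n)) ∷ pw) ∷ pws′

All-intercalate : ∀ {P : ℕ → Set} {n} → P n → ∀ Ws → ListAll (ListAll P) Ws → ListAll P (intercalate [ n ] Ws)
All-intercalate pn []           []         = []
All-intercalate pn (W ∷ [])     (pW ∷ [])  = pW
All-intercalate pn (W ∷ V ∷ Ws) (pW ∷ pWs) = All.++⁺ pW (pn ∷ All-intercalate pn (V ∷ Ws) pWs)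

intercalate-++-last : ∀ {n : ℕ} Ws w u → intercalate [ n ] (Ws ++ [ w ]) ++ u ≡ intercalate [ n ] (Ws ++ [ w ++ u ])
intercalate-++-last           []            w u = refl
intercalate-++-last {n}       (V ∷ [])      w u = ++-assoc V (n ∷ w) u
intercalate-++-last {n}       (V ∷ V′ ∷ Ws) w u =
  trans (++-assoc V _ u) (cong (λ z → V ++ n ∷ z) (intercalate-++-last (V′ ∷ Ws) w u))

∈-intercalate : ∀ {n : ℕ} W Ws w → n ∈ intercalate [ n ] (W ∷ Ws ++ [ w ])
∈-intercalate W []       w = ∈-++⁺ʳ W (here refl)
∈-intercalate W (_ ∷ Ws) w = ∈-++⁺ʳ W (here refl)

-- Unfolding ≾ and NF, and independence of the fuel

LeqStep : (Word → Word → Set) → List Word → List Word → Set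
LeqStep R As Bs = Σ (List Word) λ C → Σ (List Word) λ D → LexMax R As C × LexMax R Bs D × LexLe R C D

NFStep : ℕ → List Word → Set
NFStep f cs = 2 ≤ length cs × Linked (λ X Y → Y ≾ X) cs × ListAll (NF' f) cs

Leq-suc-min : ∀ f {A B x} → x ∈ A ++ B →
              Leq (suc f) A B ≡ LeqStep (Leq f) (split (minW (A ++ B)) A) (split (minW (A ++ B)) B)
Leq-suc-min f {_ ∷ _} _ = refl
Leq-suc-min f {[]} {_ ∷ _} _ = refl

Leq-suc-split : ∀ f {A B n As Bs} → n ∈ A ++ B → ListAll (n ≤_) (A ++ B) → split n A ≡ As → split n B ≡ Bs →
                Leq (suc f) A B ≡ LeqStep (Leq f) As Bs
Leq-suc-split f {A} {B} n∈ n≤ refl refl =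
  trans (Leq-suc-min f n∈) (cong (λ m → LeqStep (Leq f) (split m A) (split m B)) (minW-≡ n∈ n≤))

NF'-suc-split : ∀ f {W n cs} → n ∈ W → ListAll (n ≤_) W → split n W ≡ cs → NFStep f cs → NF' (suc f) W
NF'-suc-split f {W@(_ ∷ _)} n∈ n≤ refl = subst (λ m → NFStep f (split m W)) (sym (minW-≡ n∈ n≤))

Agree : (Word → Set) → (Word → Word → Set) → (Word → Word → Set) → Set
Agree P R R′ = ∀ {X Y} → P X → P Y → R X Y ⇔ R′ X Y

module _ {P : Word → Set} {R R′ : Word → Word → Set} (agree : Agree P R R′) where

  LexLe-resp : ∀ {Xs Ys} → ListAll P Xs → ListAll P Ys → LexLe R Xs Ys → LexLe R′ Xs Ys
  LexLe-resp {[]}     _          _          _                = tt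
  LexLe-resp {_ ∷ _} {_ ∷ _} (px ∷ pxs) (py ∷ pys) (inj₁ (r , ¬r)) =
    inj₁ (Equivalence.to (agree px py) r , ¬r ∘ Equivalence.from (agree py px))
  LexLe-resp {_ ∷ _} {_ ∷ _} (px ∷ pxs) (py ∷ pys) (inj₂ ((r , r′) , rs)) =
    inj₂ ((Equivalence.to (agree px py) r , Equivalence.to (agree py px) r′) , LexLe-resp pxs pys rs)

  LexMax-resp : ∀ {Xs C} → ListAll P Xs → LexMax R Xs C → LexMax R′ Xs C
  LexMax-resp pxs (C⊆ , max) = C⊆ , λ S S⊆ → LexLe-resp (All-resp-⊆ S⊆ pxs) (All-resp-⊆ C⊆ pxs) (max S S⊆)

  LeqStep-resp : ∀ {As Bs} → ListAll P As → ListAll P Bs → LeqStep R As Bs → LeqStep R′ As Bs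
  LeqStep-resp pas pbs (C , D , maxC , maxD , C≤D) =
    C , D , LexMax-resp pas maxC , LexMax-resp pbs maxD ,
    LexLe-resp (All-resp-⊆ (proj₁ maxC) pas) (All-resp-⊆ (proj₁ maxD) pbs) C≤D

module _ {R : Word → Word → Set} where

  LexMax-last : ∀ us {m} → ListAll (λ u → Strict R u m) us → R m m → LexMax R (us ++ [ m ]) [ m ]
  LexMax-last us us<m m≤m = ++⁺ˡ us ⊆-refl , λ S S⊆ → go us us<m m≤m S⊆
    where
    go : ∀ us {m S} → ListAll (λ u → Strict R u m) us → R m m → S ⊆ us ++ [ m ] → LexLe R S [ m ]
    go []       _          _   (_ ∷ʳ [])    = tt
    go []       _          m≤m (refl ∷ [])  = inj₂ ((m≤m , m≤m) , tt)
    go (u ∷ us) (_ ∷ us<m) m≤m (_ ∷ʳ S⊆)   = go us us<m m≤m S⊆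
    go (u ∷ us) (u<m ∷ _)  _   (refl ∷ S⊆) = inj₁ u<m

  LeqStep-last : ∀ us {m m′} → ListAll (λ u → Strict R u m) us → R m m → R m′ m′ → R m m′ → R m′ m →
                 LeqStep R (us ++ [ m ]) [ m′ ] × LeqStep R [ m′ ] (us ++ [ m ])
  LeqStep-last us us<m m≤m m′≤m′ m≤m′ m′≤m =
    (_ , _ , LexMax-last us us<m m≤m , LexMax-last [] [] m′≤m′ , inj₂ ((m≤m′ , m′≤m) , tt)) ,
    (_ , _ , LexMax-last [] [] m′≤m′ , LexMax-last us us<m m≤m , inj₂ ((m′≤m , m≤m′) , tt))

StrictlyWithin : ℕ → ℕ → ℕ → Set
StrictlyWithin lo d x = lo < x × x ≤ lo + d

split-minW-bound : ∀ {lo d V x} W → x ∈ V → ListAll (Within lo d) V → ListAll (minW V ≤_) W → ListAll (Within lo d) W →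
                   ListAll (ListAll (StrictlyWithin lo d)) (split (minW V) W)
split-minW-bound {V = y ∷ ys} W x∈ wV m≤W wW =
  All.map (All.map bound) (All-split (minW (y ∷ ys)) W (All.zip (wW , m≤W)))
  where
  bound : ∀ {x} → (Within _ _ x × minW (y ∷ ys) ≤ x) × x ≢ minW (y ∷ ys) → StrictlyWithin _ _ x
  bound (((_ , x≤) , m≤x) , x≢m) =
    ≤-<-trans (⊓-fold-glb y ys (All.map proj₁ wV)) (≤∧≢⇒< m≤x (x≢m ∘ sym)) , x≤

StrictlyWithin-shift : ∀ {lo d x} → StrictlyWithin lo (suc d) x → Within (suc lo) d x
StrictlyWithin-shift {lo} {d} (lo<x , x≤) = lo<x , ≤-trans x≤ (≤-reflexive (+-suc lo d))

StrictlyWithin-zero : ∀ {lo X} → ListAll (StrictlyWithin lo 0) X → X ≡ []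
StrictlyWithin-zero {lo} []                 = refl
StrictlyWithin-zero {lo} ((lo<x , x≤) ∷ _) = ⊥-elim (<⇒≱ lo<x (≤-trans x≤ (≤-reflexive (+-identityʳ lo))))

-- ≾ is defined with fuel max − min + 1, but any fuel beyond the spread of the symbols gives the
-- same relation, so each level of the construction can be compared at a fixed fuel.
Leq-fuel⇔ : ∀ lo d g g′ {A B} → ListAll (Within lo d) (A ++ B) → Leq (suc (d + g)) A B ⇔ Leq (suc (d + g′)) A B
Leq-fuel⇔-∈ : ∀ lo d g g′ {A B x} → x ∈ A ++ B → ListAll (Within lo d) (A ++ B) →
              Leq (suc (d + g)) A B ⇔ Leq (suc (d + g′)) A B
components-agree : ∀ lo d g g′ → Agree (ListAll (StrictlyWithin lo d)) (Leq (d + g)) (Leq (d + g′))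

Leq-fuel⇔ lo d g g′ {[]}    {[]}    _ = mk⇔ id id
Leq-fuel⇔ lo d g g′ {_ ∷ _} {B}     w = Leq-fuel⇔-∈ lo d g g′ {B = B} (here refl) w
Leq-fuel⇔ lo d g g′ {[]}    {_ ∷ _} w = Leq-fuel⇔-∈ lo d g g′ {A = []} (here refl) w

Leq-fuel⇔-∈ lo d g g′ {A} {B} x∈ w =
  subst₂ _⇔_ (sym (Leq-suc-min (d + g) x∈)) (sym (Leq-suc-min (d + g′) x∈))
    (mk⇔ (LeqStep-resp (components-agree lo d g g′) bA bB)
         (LeqStep-resp (components-agree lo d g′ g) bA bB))
  where
  m≤ : ListAll (minW (A ++ B) ≤_) (A ++ B)
  m≤ = All.tabulate minW-≤
  bA = split-minW-bound A x∈ w (All.++⁻ˡ A m≤) (All.++⁻ˡ A w)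
  bB = split-minW-bound B x∈ w (All.++⁻ʳ A m≤) (All.++⁻ʳ A w)

components-agree lo zero    g g′ pX pY rewrite StrictlyWithin-zero pX | StrictlyWithin-zero pY = mk⇔ id id
components-agree lo (suc d) g g′ pX pY =
  Leq-fuel⇔ (suc lo) d g g′ (All.++⁺ (All.map StrictlyWithin-shift pX) (All.map StrictlyWithin-shift pY))

NF'-fuel : ∀ lo d g g′ {W} → ListAll (Within lo d) W → NF' (suc (d + g)) W → NF' (suc (d + g′)) W
component-NF : ∀ lo d g g′ {X} → ListAll (StrictlyWithin lo d) X × NF' (d + g) X → NF' (d + g′) X

NF'-fuel lo d g g′ {[]}         _ _                    = tt
NF'-fuel lo d g g′ {W@(_ ∷ _)} w (len , linked , nfs) =
  len , linked , All.zipWith (component-NF lo d g g′) (split-minW-bound W (here refl) w (All.tabulate minW-≤) w , nfs)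

component-NF lo zero    g g′ (pX , _) rewrite StrictlyWithin-zero pX = tt
component-NF lo (suc d) g g′ (pX , nf) = NF'-fuel (suc lo) d g g′ (All.map StrictlyWithin-shift pX) nf

Leq-refuel : ∀ lo d {A B f f′} → ListAll (Within lo d) (A ++ B) → d ≤ f → d ≤ f′ → Leq (suc f) A B → Leq (suc f′) A B
Leq-refuel lo d {A} {B} w d≤f d≤f′ =
  subst (λ f → Leq (suc f) A B) (m+[n∸m]≡n d≤f′) ∘
  Equivalence.to (Leq-fuel⇔ lo d _ _ w) ∘
  subst (λ f → Leq (suc f) A B) (sym (m+[n∸m]≡n d≤f))

≾-intro : ∀ lo d {A B} → ListAll (Within lo d) (A ++ B) → Leq (suc d) A B → A ≾ B
≾-intro lo d {A} {B} w = Leq-refuel (minW (A ++ B)) (height (A ++ B)) (Within-height (A ++ B)) (height-≤ (A ++ B) w) ≤-refl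

NF'-refuel : ∀ lo d {W f f′} → ListAll (Within lo d) W → d ≤ f → d ≤ f′ → NF' (suc f) W → NF' (suc f′) W
NF'-refuel lo d {W} w d≤f d≤f′ =
  subst (λ f → NF' (suc f) W) (m+[n∸m]≡n d≤f′) ∘
  NF'-fuel lo d _ _ w ∘
  subst (λ f → NF' (suc f) W) (sym (m+[n∸m]≡n d≤f))

NF-intro : ∀ lo d {W} → ListAll (Within lo d) W → NF' (suc d) W → NF W
NF-intro lo d {W} w = NF'-refuel (minW W) (height W) (Within-height W) (height-≤ W w) ≤-refl

-- Comparing words through ranks of their components

module Ranked {Ix : Set} (R : Word → Word → Set) (e : Ix → Word) (rank : Ix → ℕ) (Ok : Ix → Set)
  (rank-⇔ : ∀ {i j} → Ok i → Ok j → R (e i) (e j) ⇔ rank i ≤ rank j) where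

  private
    to : ∀ {i j} → Ok i → Ok j → R (e i) (e j) → rank i ≤ rank j
    to oi oj = Equivalence.to (rank-⇔ oi oj)
    from : ∀ {i j} → Ok i → Ok j → rank i ≤ rank j → R (e i) (e j)
    from oi oj = Equivalence.from (rank-⇔ oi oj)

  LexLe⇒≤ₗ : ∀ {is js} → ListAll Ok is → ListAll Ok js → LexLe R (map e is) (map e js) → map rank is ≤ₗ map rank js
  LexLe⇒≤ₗ {[]}    _          _          _                 = tt
  LexLe⇒≤ₗ {_ ∷ _} {_ ∷ _} (oi ∷ ois) (oj ∷ ojs) (inj₁ (_ , ¬r)) = inj₁ (≰⇒> (¬r ∘ from oj oi))
  LexLe⇒≤ₗ {_ ∷ _} {_ ∷ _} (oi ∷ ois) (oj ∷ ojs) (inj₂ ((r , r′) , rs)) =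
    inj₂ (≤-antisym (to oi oj r) (to oj oi r′) , LexLe⇒≤ₗ ois ojs rs)

  ≤ₗ⇒LexLe : ∀ {is js} → ListAll Ok is → ListAll Ok js → map rank is ≤ₗ map rank js → LexLe R (map e is) (map e js)
  ≤ₗ⇒LexLe {[]}    _          _          _         = tt
  ≤ₗ⇒LexLe {_ ∷ _} {_ ∷ _} (oi ∷ ois) (oj ∷ ojs) (inj₁ i<j) =
    inj₁ (from oi oj (<⇒≤ i<j) , <⇒≱ i<j ∘ to oj oi)
  ≤ₗ⇒LexLe {_ ∷ _} {_ ∷ _} (oi ∷ ois) (oj ∷ ojs) (inj₂ (i≡j , rs)) =
    inj₂ ((from oi oj (≤-reflexive i≡j) , from oj oi (≤-reflexive (sym i≡j))) , ≤ₗ⇒LexLe ois ojs rs)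

  LexMax⇒≡ : ∀ {xs cs C} → ListAll Ok xs → IsLexMax (map rank xs) cs → LexMax R (map e xs) C →
             Σ (List Ix) λ C′ → C ≡ map e C′ × map rank C′ ≡ cs × ListAll Ok C′
  LexMax⇒≡ {xs} {cs} oks (cs⊆ , cs-max) (C⊆ , C-max) with ⊆-map⁻ e xs C⊆ | ⊆-map⁻ rank xs cs⊆
  ... | C′ , C′⊆ , refl | cs′ , cs′⊆ , refl =
    C′ , refl , ≤ₗ-antisym _ _ (cs-max _ (map⁺ rank C′⊆)) ranks-≥ , All-resp-⊆ C′⊆ oks
    where
    ranks-≥ : map rank cs′ ≤ₗ map rank C′
    ranks-≥ = LexLe⇒≤ₗ (All-resp-⊆ cs′⊆ oks) (All-resp-⊆ C′⊆ oks) (C-max _ (map⁺ e cs′⊆))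

  IsLexMax⇒LexMax : ∀ {xs cs} → ListAll Ok xs → IsLexMax (map rank xs) cs →
                    Σ (List Ix) λ C′ → map rank C′ ≡ cs × ListAll Ok C′ × LexMax R (map e xs) (map e C′)
  IsLexMax⇒LexMax {xs} oks (cs⊆ , cs-max) with ⊆-map⁻ rank xs cs⊆
  ... | C′ , C′⊆ , refl = C′ , refl , All-resp-⊆ C′⊆ oks , map⁺ e C′⊆ , C′-max
    where
    C′-max : ∀ S → S ⊆ map e xs → LexLe R S (map e C′)
    C′-max S S⊆ with ⊆-map⁻ e xs S⊆
    ... | S′ , S′⊆ , refl =
      ≤ₗ⇒LexLe (All-resp-⊆ S′⊆ oks) (All-resp-⊆ C′⊆ oks) (cs-max _ (map⁺ rank S′⊆))

  LeqStep⇔ : ∀ {xs ys cx cy} → ListAll Ok xs → ListAll Ok ys → IsLexMax (map rank xs) cx → IsLexMax (map rank ys) cy →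
             LeqStep R (map e xs) (map e ys) ⇔ cx ≤ₗ cy
  LeqStep⇔ ox oy mx my = mk⇔ to′ from′
    where
    to′ : LeqStep R _ _ → _
    to′ (C , D , maxC , maxD , C≤D) with LexMax⇒≡ ox mx maxC | LexMax⇒≡ oy my maxD
    ... | C′ , refl , refl , oC | D′ , refl , refl , oD = LexLe⇒≤ₗ oC oD C≤D
    from′ : _ → LeqStep R _ _
    from′ cx≤cy with IsLexMax⇒LexMax ox mx | IsLexMax⇒LexMax oy my
    ... | C′ , refl , oC , maxC | D′ , refl , oD , maxD = map e C′ , map e D′ , maxC , maxD , ≤ₗ⇒LexLe oC oD cx≤cy

-- Words over {2, 3}

replicate-Leq⇔-∈ : ∀ c a b → c ∈ replicate a c ++ replicate b c → Leq 1 (replicate a c) (replicate b c) ⇔ a ≤ b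
replicate-Leq⇔-∈ c a b c∈ =
  subst (_⇔ a ≤ b) (sym (Leq-suc-split 0 c∈ c≤ (split-rep a) (split-rep b)))
    (⇔.trans (LeqStep⇔ (oks a) (oks b) (max a) (max b)) (⇔.trans (replicate-≤ₗ⇔ (suc a) (suc b)) (mk⇔ s≤s⁻¹ s≤s)))
  where
  open Ranked (Leq 0) (λ (_ : ⊤) → []) (λ _ → 0) (λ _ → ⊤) (λ _ _ → mk⇔ (λ _ → z≤n) (λ _ → tt))
  c≤ : ListAll (c ≤_) (replicate a c ++ replicate b c)
  c≤ = All.++⁺ (All.replicate⁺ a ≤-refl) (All.replicate⁺ b ≤-refl)
  split-rep : ∀ a → split c (replicate a c) ≡ map (λ _ → []) (replicate (suc a) tt)
  split-rep a = trans (split-replicate c a) (sym (map-replicate _ (suc a) tt))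
  oks : ∀ a → ListAll (λ _ → ⊤) (replicate (suc a) tt)
  oks a = All.replicate⁺ (suc a) tt
  max : ∀ a → IsLexMax (map (λ _ → 0) (replicate (suc a) tt)) (replicate (suc a) 0)
  max a rewrite map-replicate (λ _ → 0) (suc a) tt = nonIncreasing⇒isLexMax (replicate-nonIncreasing (suc a) 0)

replicate-Leq⇔ : ∀ c a b → Leq 1 (replicate a c) (replicate b c) ⇔ a ≤ b
replicate-Leq⇔ c zero    zero    = mk⇔ (λ _ → z≤n) (λ _ → tt)
replicate-Leq⇔ c (suc a) b       = replicate-Leq⇔-∈ c (suc a) b (here refl)
replicate-Leq⇔ c zero    (suc b) = replicate-Leq⇔-∈ c zero (suc b) (here refl)

infix 30 3^_

3^_ : ℕ → Word
3^ a = replicate a 3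

3^-Within : ∀ a → ListAll (Within 3 0) (3^ a)
3^-Within a = All.replicate⁺ a (≤-refl , ≤-refl)

IWord : List ℕ → ℕ → Word
IWord L m = concat (map I L) ++ 3^ m

IWord-All : ∀ {P : ℕ → Set} → P 2 → P 3 → ∀ L m → ListAll P (IWord L m)
IWord-All p2 p3 []      m = All.replicate⁺ m p3
IWord-All p2 p3 (a ∷ L) m =
  subst (ListAll _) (sym (++-assoc (I a) _ (3^ m)))
    (All.++⁺ (All.++⁺ (All.replicate⁺ a p3) (p2 ∷ [])) (IWord-All p2 p3 L m))

2∈IWord : ∀ a L m → 2 ∈ IWord (a ∷ L) m
2∈IWord a L m = ∈-++⁺ˡ (∈-++⁺ˡ (∈-++⁺ʳ (3^ a) (here refl)))

split-IWord : ∀ L m → split 2 (IWord L m) ≡ map 3^_ (L ++ [ m ])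
split-IWord []      m = split-free (3^ m) (All.replicate⁺ m (λ ()))
split-IWord (a ∷ L) m = begin
  split 2 ((I a ++ concat (map I L)) ++ 3^ m) ≡⟨ cong (split 2) (++-assoc (I a) _ (3^ m)) ⟩
  split 2 ((3^ a ++ [ 2 ]) ++ IWord L m)      ≡⟨ cong (split 2) (++-assoc (3^ a) [ 2 ] (IWord L m)) ⟩
  split 2 (3^ a ++ 2 ∷ IWord L m)             ≡⟨ split-++ (3^ a) (IWord L m) (All.replicate⁺ a (λ ())) ⟩
  3^ a ∷ split 2 (IWord L m)                  ≡⟨ cong (3^ a ∷_) (split-IWord L m) ⟩
  3^ a ∷ map 3^_ (L ++ [ m ])                 ∎
  where open ≡-Reasoning

IWord-Leq⇔-∈ : ∀ L m L′ m′ → 2 ∈ IWord L m ++ IWord L′ m′ →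
               NonIncreasing (L ++ [ m ]) → NonIncreasing (L′ ++ [ m′ ]) →
               Leq 2 (IWord L m) (IWord L′ m′) ⇔ L ++ [ m ] ≤ₗ L′ ++ [ m′ ]
IWord-Leq⇔-∈ L m L′ m′ 2∈ desc desc′ =
  subst (_⇔ L ++ [ m ] ≤ₗ L′ ++ [ m′ ]) (sym (Leq-suc-split 1 2∈ 2≤ (split-IWord L m) (split-IWord L′ m′)))
    (subst₂ (λ xs ys → LeqStep (Leq 1) (map 3^_ (L ++ [ m ])) (map 3^_ (L′ ++ [ m′ ])) ⇔ xs ≤ₗ ys) (map-id _) (map-id _)
      (LeqStep⇔ (All.tabulate _) (All.tabulate _) (lexMax desc) (lexMax desc′)))
  where
  open Ranked (Leq 1) 3^_ id (λ _ → ⊤) (λ _ _ → replicate-Leq⇔ 3 _ _)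
  2≤ : ListAll (2 ≤_) (IWord L m ++ IWord L′ m′)
  2≤ = All.++⁺ (IWord-All ≤-refl (n≤1+n 2) L m) (IWord-All ≤-refl (n≤1+n 2) L′ m′)
  lexMax : ∀ {xs} → NonIncreasing xs → IsLexMax (map id xs) (map id xs)
  lexMax {xs} desc = nonIncreasing⇒isLexMax (subst NonIncreasing (sym (map-id xs)) desc)

IWord-Leq⇔ : ∀ L m L′ m′ → NonIncreasing (L ++ [ m ]) → NonIncreasing (L′ ++ [ m′ ]) →
             Leq 2 (IWord L m) (IWord L′ m′) ⇔ L ++ [ m ] ≤ₗ L′ ++ [ m′ ]
IWord-Leq⇔ []      m []       m′ _ _ =
  ⇔.trans (⇔.sym (Leq-fuel⇔ 3 0 0 1 (All.++⁺ (3^-Within m) (3^-Within m′))))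
    (⇔.trans (replicate-Leq⇔ 3 m m′) (⇔.sym []-≤ₗ⇔))
IWord-Leq⇔ (a ∷ L) m L′      m′ = IWord-Leq⇔-∈ (a ∷ L) m L′ m′ (∈-++⁺ˡ (2∈IWord a L m))
IWord-Leq⇔ []      m (a ∷ L′) m′ = IWord-Leq⇔-∈ [] m (a ∷ L′) m′ (∈-++⁺ʳ (3^ m) (2∈IWord a L′ m′))

replicate-NF : ∀ c a → NF' 1 (replicate a c)
replicate-NF c zero    = tt
replicate-NF c (suc a) =
  NF'-suc-split 0 (here refl) (All.replicate⁺ (suc a) ≤-refl) (split-replicate c (suc a))
    (s≤s (s≤s z≤n) , empties-linked (suc (suc a)) , All.replicate⁺ (suc (suc a)) tt)
  where
  empties-linked : ∀ n → Linked (λ X Y → Y ≾ X) (replicate n [])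
  empties-linked zero          = []
  empties-linked (suc zero)    = [-]
  empties-linked (suc (suc n)) = tt ∷ empties-linked (suc n)

3^-≾ : ∀ {a b} → a ≤ b → 3^ a ≾ 3^ b
3^-≾ {a} {b} a≤b =
  ≾-intro 3 0 (All.++⁺ (3^-Within a) (3^-Within b))
    (Equivalence.from (replicate-Leq⇔ 3 a b) a≤b)

IWord-NF : ∀ L m → NonIncreasing (L ++ [ m ]) → NF' 2 (IWord L m)
IWord-NF []      m _    = NF'-refuel 3 0 (3^-Within m) z≤n z≤n (replicate-NF 3 m)
IWord-NF (a ∷ L) m desc =
  NF'-suc-split 1 (2∈IWord a L m) (IWord-All ≤-refl (n≤1+n 2) (a ∷ L) m) (split-IWord (a ∷ L) m)
    (two≤length L , blocks-linked desc , All.map⁺ (All.tabulate λ {b} _ → replicate-NF 3 b))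
  where
  two≤length : ∀ L → 2 ≤ length (map 3^_ (a ∷ L ++ [ m ]))
  two≤length []      = s≤s (s≤s z≤n)
  two≤length (_ ∷ _) = s≤s (s≤s z≤n)
  blocks-linked : ∀ {xs} → NonIncreasing xs → Linked (λ X Y → Y ≾ X) (map 3^_ xs)
  blocks-linked []           = []
  blocks-linked [-]          = [-]
  blocks-linked (b≤a ∷ desc) = 3^-≾ b≤a ∷ blocks-linked desc

data Piece : Set where
  short full : ℕ → Piece

index : Piece → ℕ
index (short k) = k
index (full k)  = k

module Pieces (h : ℕ) where

  D : ℕ → List ℕ
  D k = reverse (applyUpTo (k +_) (h ∸ k))

  exponent : Piece → ℕ
  exponent (short k) = k ∸ 1
  exponent (full k)  = k

  exponents : Piece → List ℕ
  exponents p = D (index p) ++ [ exponent p ]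

  -- word (short k) is I_{h−1} ⋯ I_k 3^{k−1}, i.e. K_{h,k} without its last 3, and word (full k) is K_{h,k}.
  word : Piece → Word
  word p = IWord (D (index p)) (exponent p)

  -- The exponent lists h−1, …, k, k−1 and h−1, …, k, k are ordered lexicographically as these ranks.
  rank : Piece → ℕ
  rank (short k) = h ∸ k
  rank (full k)  = h + k

  InRange : Piece → Set
  InRange p = 1 ≤ index p × index p ≤ h

  D-prefix : ∀ {i j} → i < j → j < h → Σ (List ℕ) λ rest → D (suc i) ≡ D (suc j) ++ j ∷ rest
  D-prefix {i} i<j j<h with ≤⇒offset i<j | ≤⇒offset j<h
  ... | a , refl | b , h≡ = applyDownFrom (suc i +_) a , (begin
    D (suc i)                                       ≡⟨ reverse-applyUpTo _ (h ∸ suc i) ⟩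
    applyDownFrom (suc i +_) (h ∸ suc i)            ≡⟨ cong (applyDownFrom (suc i +_)) h∸i ⟩
    applyDownFrom (suc i +_) (b + suc a)            ≡⟨ applyDownFrom-+ (suc i) (suc a) b ⟩
    applyDownFrom ((suc i + suc a) +_) b ++ applyDownFrom (suc i +_) (suc a)
      ≡⟨ cong (λ n → applyDownFrom (n +_) b ++ applyDownFrom (suc i +_) (suc a)) (+-suc (suc i) a) ⟩
    applyDownFrom (suc j +_) b ++ j ∷ applyDownFrom (suc i +_) a
      ≡⟨ cong (λ n → applyDownFrom (suc j +_) n ++ j ∷ applyDownFrom (suc i +_) a) h∸j ⟩
    applyDownFrom (suc j +_) (h ∸ suc j) ++ j ∷ applyDownFrom (suc i +_) a
      ≡⟨ cong (_++ j ∷ applyDownFrom (suc i +_) a) (sym (reverse-applyUpTo _ (h ∸ suc j))) ⟩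
    D (suc j) ++ j ∷ applyDownFrom (suc i +_) a     ∎)
    where
    open ≡-Reasoning
    j = suc i + a
    h∸i : h ∸ suc i ≡ b + suc a
    h∸i = trans (cong (_∸ suc i) (trans h≡ (offsets-+ i a b))) (m+n∸m≡n (suc i) (b + suc a))
    h∸j : b ≡ h ∸ suc j
    h∸j = sym (trans (cong (_∸ suc j) h≡) (m+n∸m≡n (suc j) b))

  rank-<⇒<ₗ : ∀ {p q} → InRange p → InRange q → rank p < rank q → exponents p <ₗ exponents q
  rank-<⇒<ₗ {short (suc i)} {short (suc j)} (_ , i<h) (_ , j<h) r<r
    with D-prefix (≰⇒> λ i≤j → <⇒≱ r<r (∸-monoʳ-≤ h (s≤s i≤j))) i<h
  ... | rest , eq rewrite eq = prefix-<ₗ (D (suc i)) i rest j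
  rank-<⇒<ₗ {short (suc i)} {full (suc j)} (_ , i<h) (_ , j<h) _ with <-cmp i j
  ... | tri< i<j _ _ with D-prefix i<j j<h
  ...   | rest , eq rewrite eq = differ-<ₗ (D (suc j)) rest [ i ] [] (n<1+n j)
  rank-<⇒<ₗ {short (suc i)} {full (suc j)} _ _ _ | tri≈ _ refl _ = ++⁺-<ₗ (D (suc i)) (inj₁ (n<1+n i))
  rank-<⇒<ₗ {short (suc i)} {full (suc j)} (_ , i<h) (_ , j<h) _ | tri> _ _ j<i with D-prefix j<i i<h
  ...   | rest , eq rewrite eq = prefix-<ₗ (D (suc i)) i rest (suc j)
  rank-<⇒<ₗ {full (suc i)} {short (suc j)} _ _ r<r = ⊥-elim (<⇒≱ r<r (≤-trans (m∸n≤m h (suc j)) (m≤m+n h (suc i))))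
  rank-<⇒<ₗ {full (suc i)} {full (suc j)} (_ , i<h) (_ , j<h) r<r with D-prefix (s≤s⁻¹ (+-cancelˡ-< h _ _ r<r)) j<h
  ... | rest , eq rewrite eq = differ-<ₗ (D (suc j)) rest [ suc i ] [] (n<1+n j)

  short<full : ∀ k {k′} → 1 ≤ k′ → h ∸ k < h + k′
  short<full k 1≤k′ = ≤-<-trans (m∸n≤m h k) (m<m+n h 1≤k′)

  rank-injective : ∀ {p q} → InRange p → InRange q → rank p ≡ rank q → p ≡ q
  rank-injective {short k} {short k′} (_ , k≤h) (_ , k′≤h) r≡r =
    cong short (trans (sym (m∸[m∸n]≡n k≤h)) (trans (cong (h ∸_) r≡r) (m∸[m∸n]≡n k′≤h)))
  rank-injective {short k} {full k′}  _ (1≤k′ , _) r≡r = ⊥-elim (<-irrefl r≡r (short<full k 1≤k′))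
  rank-injective {full k}  {short k′} (1≤k , _) _ r≡r = ⊥-elim (<-irrefl (sym r≡r) (short<full k′ 1≤k))
  rank-injective {full k}  {full k′}  _ _ r≡r = cong full (+-cancelˡ-≡ h k k′ r≡r)

  exponents-nonIncreasing : ∀ p → NonIncreasing (exponents p)
  exponents-nonIncreasing p =
    subst (λ L → NonIncreasing (L ++ [ exponent p ])) (sym (reverse-applyUpTo _ (h ∸ index p)))
      (applyDownFrom-+-nonIncreasing (index p) (h ∸ index p) (exponent≤index p))
    where
    exponent≤index : ∀ p → exponent p ≤ index p
    exponent≤index (short k) = m∸n≤m k 1
    exponent≤index (full k)  = ≤-refl

  rank-⇔ : ∀ {p q} → InRange p → InRange q → Leq 2 (word p) (word q) ⇔ rank p ≤ rank q
  rank-⇔ {p} {q} op oq =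
    ⇔.trans (IWord-Leq⇔ _ _ _ _ (exponents-nonIncreasing p) (exponents-nonIncreasing q))
      (≤ₗ⇔≤-by-rank InRange exponents rank (λ {p} {q} → rank-<⇒<ₗ {p} {q}) (λ {p} {q} → rank-injective {p} {q})
        {p} {q} op oq)

  word-All : ∀ {P : ℕ → Set} → P 2 → P 3 → ∀ p → ListAll P (word p)
  word-All p2 p3 p = IWord-All p2 p3 (D (index p)) (exponent p)

  word-Within : ∀ p → ListAll (Within 2 1) (word p)
  word-Within = word-All (≤-refl , n≤1+n 2) (n≤1+n 2 , ≤-refl)

  Z : Word
  Z = word (short 1)

  padZ1 : ℕ → Word → Word
  padZ1 n c = concat (replicate n (Z ++ [ 1 ])) ++ c

  padZ1-All : ∀ {P : ℕ → Set} → P 1 → P 2 → P 3 → ∀ n p → ListAll P (padZ1 n (word p))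
  padZ1-All p1 p2 p3 n p =
    All.++⁺ (All.concat⁺ (All.replicate⁺ n (All.++⁺ (word-All p2 p3 (short 1)) (p1 ∷ [])))) (word-All p2 p3 p)

  padZ1-suc : ∀ n c → padZ1 (suc n) c ≡ Z ++ 1 ∷ padZ1 n c
  padZ1-suc n c = trans (++-assoc (Z ++ [ 1 ]) _ c) (++-assoc Z [ 1 ] _)

  padZ1-Within : ∀ n p → ListAll (Within 1 2) (padZ1 n (word p))
  padZ1-Within = padZ1-All (≤-refl , s≤s z≤n) (s≤s z≤n , s≤s (s≤s z≤n)) (s≤s z≤n , ≤-refl)

  1∈padZ1 : ∀ n c → 1 ∈ padZ1 (suc n) c
  1∈padZ1 n c = subst (1 ∈_) (sym (padZ1-suc n c)) (∈-++⁺ʳ Z (here refl))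

  split-padZ1 : ∀ n p → split 1 (padZ1 n (word p)) ≡ map word (replicate n (short 1) ++ [ p ])
  split-padZ1 zero    p = split-free (word p) (word-All (λ ()) (λ ()) p)
  split-padZ1 (suc n) p = begin
    split 1 (padZ1 (suc n) (word p))   ≡⟨ cong (split 1) (padZ1-suc n (word p)) ⟩
    split 1 (Z ++ 1 ∷ padZ1 n (word p)) ≡⟨ split-++ Z _ (word-All (λ ()) (λ ()) (short 1)) ⟩
    Z ∷ split 1 (padZ1 n (word p))      ≡⟨ cong (Z ∷_) (split-padZ1 n p) ⟩
    Z ∷ map word (replicate n (short 1) ++ [ p ]) ∎
    where open ≡-Reasoning

  word-NF : ∀ p → NF' 2 (word p)
  word-NF p = IWord-NF (D (index p)) (exponent p) (exponents-nonIncreasing p)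

  word-≾ : ∀ p q → InRange p → InRange q → rank p ≤ rank q → word p ≾ word q
  word-≾ p q op oq rp≤rq =
    ≾-intro 2 1 (All.++⁺ (word-Within p) (word-Within q))
      (Equivalence.from (rank-⇔ {p} {q} op oq) rp≤rq)

  short-++-3 : ∀ {k} → 1 ≤ k → word (short k) ++ [ 3 ] ≡ word (full k)
  short-++-3 {suc j} _ =
    trans (++-assoc (concat (map I (D (suc j)))) (3^ j) [ 3 ]) (cong (concat (map I (D (suc j))) ++_) (replicate-∷ʳ j))

  padZ1-short-++-3 : ∀ n {k} → 1 ≤ k → padZ1 n (word (short k)) ++ [ 3 ] ≡ padZ1 n (word (full k))
  padZ1-short-++-3 n 1≤k = trans (++-assoc Z1s _ [ 3 ]) (cong (Z1s ++_) (short-++-3 1≤k))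
    where Z1s = concat (replicate n (Z ++ [ 1 ]))

  module Construction (1≤h : 1 ≤ h) where

    open Ranked (Leq 2) word rank InRange (λ {p} {q} → rank-⇔ {p} {q})

    ranks : ℕ → Piece → List ℕ
    ranks n p = replicate n (h ∸ 1) ++ [ rank p ]

    padZ1-Leq⇔ : ∀ n n′ p p′ {cs cs′} → 1 ∈ padZ1 n (word p) ++ padZ1 n′ (word p′) → InRange p → InRange p′ →
                 IsLexMax (ranks n p) cs → IsLexMax (ranks n′ p′) cs′ →
                 Leq 3 (padZ1 n (word p)) (padZ1 n′ (word p′)) ⇔ cs ≤ₗ cs′
    padZ1-Leq⇔ n n′ p p′ 1∈ op op′ max max′ =
      subst (_⇔ _) (sym (Leq-suc-split 2 1∈ 1≤ (split-padZ1 n p) (split-padZ1 n′ p′)))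
        (LeqStep⇔ (oks n op) (oks n′ op′) (ranks-isLexMax n p max) (ranks-isLexMax n′ p′ max′))
      where
      1≤ = All.++⁺ (padZ1-All ≤-refl (s≤s z≤n) (s≤s z≤n) n p) (padZ1-All ≤-refl (s≤s z≤n) (s≤s z≤n) n′ p′)
      oks : ∀ n {p} → InRange p → ListAll InRange (replicate n (short 1) ++ [ p ])
      oks n op = All.++⁺ (All.replicate⁺ n (≤-refl , 1≤h)) (op ∷ [])
      ranks-isLexMax : ∀ n p {cs} → IsLexMax (ranks n p) cs → IsLexMax (map rank (replicate n (short 1) ++ [ p ])) cs
      ranks-isLexMax n p = subst (λ xs → IsLexMax xs _)
        (sym (trans (map-++ rank (replicate n (short 1)) [ p ]) (cong (_++ [ rank p ]) (map-replicate rank n (short 1)))))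

    short-isLexMax : ∀ n {k} → 1 ≤ k → IsLexMax (ranks n (short k)) (ranks n (short k))
    short-isLexMax n 1≤k = nonIncreasing⇒isLexMax (replicate-++-nonIncreasing n (∸-monoʳ-≤ h 1≤k))

    full-isLexMax : ∀ n {k} → 1 ≤ k → IsLexMax (ranks n (full k)) [ h + k ]
    full-isLexMax n 1≤k = isLexMax-∷ʳ (replicate n (h ∸ 1)) (All.replicate⁺ n (short<full 1 1≤k))

    padZ1-full-Leq : ∀ n n′ {k} → 1 ∈ padZ1 n (word (full k)) ++ padZ1 n′ (word (full k)) → InRange (full k) →
                     Leq 3 (padZ1 n (word (full k))) (padZ1 n′ (word (full k)))
    padZ1-full-Leq n n′ {k} 1∈ ok@(1≤k , _) =
      Equivalence.from (padZ1-Leq⇔ n n′ (full k) (full k) 1∈ ok ok (full-isLexMax n 1≤k) (full-isLexMax n′ 1≤k))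
        (≤ₗ-refl [ h + k ])

    padZ1-short<full : ∀ j n {k k′} → InRange (short k′) → InRange (full k) →
                       Strict (Leq 3) (padZ1 (suc j) (word (short k′))) (padZ1 n (word (full k)))
    padZ1-short<full j n {k} {k′} ok′@(1≤k′ , _) ok@(1≤k , _) = short≤full , ¬full≤short ∘ Equivalence.to full⇔short
      where
      h∸1<h+k = short<full 1 1≤k
      short≤full = Equivalence.from
        (padZ1-Leq⇔ (suc j) n (short k′) (full k) (∈-++⁺ˡ (1∈padZ1 j _)) ok′ ok
          (short-isLexMax (suc j) 1≤k′) (full-isLexMax n 1≤k))
        (inj₁ h∸1<h+k)
      full⇔short = padZ1-Leq⇔ n (suc j) (full k) (short k′) (∈-++⁺ʳ (padZ1 n (word (full k))) (1∈padZ1 j _)) ok ok′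
        (full-isLexMax n 1≤k) (short-isLexMax (suc j) 1≤k′)
      ¬full≤short : ¬ [ h + k ] ≤ₗ ranks (suc j) (short k′)
      ¬full≤short (inj₁ h+k<h∸1)    = <-asym h+k<h∸1 h∸1<h+k
      ¬full≤short (inj₂ (h+k≡ , _)) = <-irrefl (sym h+k≡) h∸1<h+k

    padZ1-short-Leq : ∀ l {k k′} → InRange (short k) → InRange (short k′) →
                    Leq 3 (padZ1 (suc l) (word (short k′))) (padZ1 (suc (suc l)) (word (short k)))
    padZ1-short-Leq l {k} {k′} ok@(1≤k , _) ok′@(1≤k′ , _) =
      Equivalence.from (padZ1-Leq⇔ (suc l) (suc (suc l)) (short k′) (short k) (∈-++⁺ˡ (1∈padZ1 l _)) ok′ ok
          (short-isLexMax (suc l) 1≤k′) (short-isLexMax (suc (suc l)) 1≤k))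
        (replicate-++-≤ₗ (suc l) _ (∸-monoʳ-≤ h 1≤k′))

    IsComponent : Word → Set
    IsComponent W = Σ ℕ λ j → Σ ℕ λ k → InRange (short k) × W ≡ padZ1 (suc j) (word (short k))

    component-All : ∀ {P : ℕ → Set} → P 1 → P 2 → P 3 → ∀ {W} → IsComponent W → ListAll P W
    component-All p1 p2 p3 (j , k , _ , refl) = padZ1-All p1 p2 p3 (suc j) (short k)

    full-Leq-full : ∀ {k} → InRange (full k) → Leq 3 (word (full k)) (word (full k))
    full-Leq-full {k} ok =
      Leq-refuel 2 1 (All.++⁺ (word-Within (full k)) (word-Within (full k))) ≤-refl (s≤s z≤n)
        (Equivalence.from (rank-⇔ {full k} {full k} ok ok) ≤-refl)

    full-∼ : ∀ Ws n {k} → InRange (full k) → ListAll IsComponent Ws →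
             word (full k) ∼ intercalate [ 0 ] (Ws ++ [ padZ1 (suc n) (word (full k)) ])
    full-∼ [] n {k} ok [] =
      ≾-intro 1 2 (All.++⁺ (padZ1-Within 0 (full k)) (padZ1-Within (suc n) (full k)))
        (padZ1-full-Leq 0 (suc n) (∈-++⁺ʳ (word (full k)) (1∈padZ1 n _)) ok) ,
      ≾-intro 1 2 (All.++⁺ (padZ1-Within (suc n) (full k)) (padZ1-Within 0 (full k)))
        (padZ1-full-Leq (suc n) 0 (∈-++⁺ˡ (1∈padZ1 n _)) ok)
    full-∼ (W ∷ Ws) n {k} ok comps =
      ≾-intro 0 3 (All.map (z≤n ,_) (All.++⁺ K-W3 X-W3))
        (subst id (sym (Leq-suc-split 3 (∈-++⁺ʳ Kₖ 0∈X) 0≤ split-K split-X)) (proj₂ steps)) ,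
      ≾-intro 0 3 (All.map (z≤n ,_) (All.++⁺ X-W3 K-W3))
        (subst id (sym (Leq-suc-split 3 (∈-++⁺ˡ 0∈X) 0≤ split-X split-K)) (proj₁ steps))
      where
      Kₖ = word (full k)
      m = padZ1 (suc n) Kₖ
      X = intercalate [ 0 ] (W ∷ Ws ++ [ m ])
      0∈X = ∈-intercalate W Ws m
      K-W3 : W3 Kₖ
      K-W3 = word-All (s≤s (s≤s z≤n)) ≤-refl (full k)
      parts-All : ∀ {P : ℕ → Set} → P 1 → P 2 → P 3 → ListAll (ListAll P) (W ∷ Ws ++ [ m ])
      parts-All p1 p2 p3 = All.++⁺ (All.map (component-All p1 p2 p3) comps) (padZ1-All p1 p2 p3 (suc n) (full k) ∷ [])
      X-W3 : W3 X
      X-W3 = All-intercalate z≤n _ (parts-All (s≤s z≤n) (s≤s (s≤s z≤n)) ≤-refl)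
      0≤ : ∀ {A} → ListAll (0 ≤_) A
      0≤ = All.tabulate (λ _ → z≤n)
      split-K : split 0 Kₖ ≡ [ Kₖ ]
      split-K = split-free Kₖ (word-All (λ ()) (λ ()) (full k))
      split-X : split 0 X ≡ W ∷ Ws ++ [ m ]
      split-X = split-intercalate W (Ws ++ [ m ]) (parts-All (λ ()) (λ ()) (λ ()))
      below-m : ∀ {U} → IsComponent U → Strict (Leq 3) U m
      below-m (j , k′ , ok′ , refl) = padZ1-short<full j (suc n) ok′ ok
      steps = LeqStep-last (W ∷ Ws) (All.map below-m comps)
        (padZ1-full-Leq (suc n) (suc n) (∈-++⁺ˡ (1∈padZ1 n Kₖ)) ok) (full-Leq-full ok)
        (padZ1-full-Leq (suc n) 0 (∈-++⁺ˡ (1∈padZ1 n Kₖ)) ok)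
        (padZ1-full-Leq 0 (suc n) (∈-++⁺ʳ Kₖ (1∈padZ1 n Kₖ)) ok)


    padZ1-NF : ∀ n {k} → InRange (short k) → NF' 3 (padZ1 (suc n) (word (short k)))
    padZ1-NF n {k} ok@(1≤k , _) =
      NF'-suc-split 2 (1∈padZ1 n (word (short k))) (padZ1-All ≤-refl (s≤s z≤n) (s≤s z≤n) (suc n) (short k))
        (split-padZ1 (suc n) (short k))
        (two≤length n , linked n , All.map⁺ {xs = replicate (suc n) (short 1) ++ [ short k ]} (All.tabulate λ {p} _ → word-NF p))
      where
      Z-range : InRange (short 1)
      Z-range = ≤-refl , 1≤h
      two≤length : ∀ n → 2 ≤ length (map word (replicate (suc n) (short 1) ++ [ short k ]))
      two≤length zero    = s≤s (s≤s z≤n)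
      two≤length (suc n) = s≤s (s≤s z≤n)
      linked : ∀ n → Linked (λ X Y → Y ≾ X) (map word (replicate (suc n) (short 1) ++ [ short k ]))
      linked zero    = word-≾ (short k) (short 1) ok Z-range (∸-monoʳ-≤ h 1≤k) ∷ [-]
      linked (suc n) = word-≾ (short 1) (short 1) Z-range Z-range ≤-refl ∷ linked n

    -- components [k_r, …, k_1] = [A_r, …, A_1].
    components : List ℕ → List Word
    components []      = []
    components (k ∷ L) = padZ1 (suc (length L)) (word (short k)) ∷ components L

    components-All : ∀ {P : ℕ → Set} → P 1 → P 2 → P 3 → ∀ L → ListAll (ListAll P) (components L)
    components-All p1 p2 p3 []      = []
    components-All p1 p2 p3 (k ∷ L) = padZ1-All p1 p2 p3 (suc (length L)) (short k) ∷ components-All p1 p2 p3 L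

    components-W3 : ∀ L → W3 (intercalate [ 0 ] (components L))
    components-W3 L = All-intercalate z≤n _ (components-All (s≤s z≤n) (s≤s (s≤s z≤n)) ≤-refl L)

    split-components : ∀ k L → split 0 (intercalate [ 0 ] (components (k ∷ L))) ≡ components (k ∷ L)
    split-components k L = split-intercalate _ _ (components-All (λ ()) (λ ()) (λ ()) (k ∷ L))

    components-NF : ∀ k L → ListAll (InRange ∘ short) (k ∷ L) → NF (intercalate [ 0 ] (components (k ∷ L)))
    components-NF k []       (ok ∷ []) =
      NF-intro 1 2 (padZ1-Within 1 (short k)) (padZ1-NF 0 ok)
    components-NF k (k′ ∷ L) oks =
      NF-intro 0 3 (All.map (z≤n ,_) (components-W3 (k ∷ k′ ∷ L)))
        (NF'-suc-split 3 (∈-++⁺ʳ (padZ1 (suc (suc (length L))) (word (short k))) (here refl)) (All.tabulate λ _ → z≤n)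
          (split-components k (k′ ∷ L))
          (s≤s (s≤s z≤n) , linked (k ∷ k′ ∷ L) oks , NFs (k ∷ k′ ∷ L) oks))
      where
      linked : ∀ L → ListAll (InRange ∘ short) L → Linked (λ X Y → Y ≾ X) (components L)
      linked []           _                 = []
      linked (k ∷ [])     _                 = [-]
      linked (k ∷ k′ ∷ L) (ok ∷ ok′ ∷ oks) =
        ≾-intro 1 2 (All.++⁺ (padZ1-Within (suc (length L)) (short k′)) (padZ1-Within (suc (suc (length L))) (short k)))
          (padZ1-short-Leq (length L) ok ok′) ∷ linked (k′ ∷ L) (ok′ ∷ oks)
      NFs : ∀ L → ListAll (InRange ∘ short) L → ListAll (NF' 3) (components L)
      NFs []      []         = []
      NFs (k ∷ L) (ok ∷ oks) = padZ1-NF (length L) ok ∷ NFs L oks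

    full-NF : ∀ {k} → InRange (full k) → NF (K h k)
    full-NF {k} _ = NF-intro 2 1 (word-Within (full k)) (word-NF (full k))

    prefixes-◇ : ∀ Ws L → ListAll IsComponent Ws → ListAll (InRange ∘ short) L →
      Pointwise (IsDiamond 3) (applyUpTo (λ j → intercalate [ 0 ] (Ws ++ take (suc j) (components L))) (length (components L)))
                (map (K h) L)
    prefixes-◇ Ws []      _     _          = []
    prefixes-◇ Ws (k ∷ L) comps (ok ∷ oks) =
      (full-NF ok , subst (K h k ∼_) (sym head-eq) (full-∼ Ws (length L) ok comps)) ∷
      subst (λ xs → Pointwise (IsDiamond 3) xs (map (K h) L))
        (applyUpTo-cong (λ j → cong (intercalate [ 0 ]) (++-assoc Ws [ C ] (take (suc j) (components L)))) (length (components L)))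
        (prefixes-◇ (Ws ++ [ C ]) L (All.++⁺ comps ((length L , k , ok , refl) ∷ [])) oks)
      where
      C = padZ1 (suc (length L)) (word (short k))
      head-eq : intercalate [ 0 ] (Ws ++ [ C ]) ++ [ 3 ] ≡ intercalate [ 0 ] (Ws ++ [ padZ1 (suc (length L)) (word (full k)) ])
      head-eq = trans (intercalate-++-last Ws C [ 3 ])
        (cong (λ c → intercalate [ 0 ] (Ws ++ [ c ])) (padZ1-short-++-3 (suc (length L)) (proj₁ ok)))

    components-IsU : ∀ k L → ListAll (InRange ∘ short) (k ∷ L) →
                     IsU (intercalate [ 0 ] (components (k ∷ L))) (map (K h) (reverse (k ∷ L)))
    components-IsU k L oks =
      subst₂ (λ Cs Ks → Pointwise (IsDiamond 3) (reverse (applyUpTo (λ j → intercalate [ 0 ] (take (suc j) Cs)) (length Cs))) Ks)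
        (sym (split-components k L))
        (sym (reverse-map (K h) (k ∷ L)))
        (Pointwise.reverse⁺ (prefixes-◇ [] (k ∷ L) [] oks))

    realise : ∀ L → 1 ≤ length L → ListAll (InRange ∘ short) L →
              Σ Word λ A → W3 A × NF A × IsU A (map (K h) (reverse L))
    realise (k ∷ L) _ oks =
      intercalate [ 0 ] (components (k ∷ L)) ,
      components-W3 (k ∷ L) ,
      components-NF k L oks ,
      components-IsU k L oks

lemma7 : (h r : ℕ) (k : Vec ℕ r) → 1 ≤ h → 1 ≤ r →
    All (λ kᵢ → 1 ≤ kᵢ × kᵢ ≤ h) k →
    Σ Word λ A → W3 A × NF A × IsU A (map (K h) (toList k))
lemma7 h r k 1≤h 1≤r k-range =
  subst (λ ks → Σ Word λ A → W3 A × NF A × IsU A (map (K h) ks)) (reverse-involutive (toList k))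
    (realise (reverse (toList k)) (subst (1 ≤_) (sym (trans (length-reverse (toList k)) (length-toList k))) 1≤r)
      (All.tabulate λ x∈ → All.lookup (VAll.toList⁺ k-range) (Any.reverse⁻ x∈)))
  where
  open Pieces h
  open Construction 1≤h
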